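{- Let $L$ be a lattice and $M$ a primitive sublattice of $L$ of rank $m$. Suppose that $K$ is a lattice of rank $k$ which is represented by $L$ but not by $M$. Then there exists a constant $C$, depending only on $k$ and $m$, such that $$\mu_{m+1}(L)\le C\max\{\mu_k(K),\mu_m(M)\}.$$ The same conclusion holds if instead $K$ is primitively represented by $L$ but not primitively represented by $M$. Furthermore, the constant $C$ can be taken to be $1$ when $\max\{k,m\}\le 4$.
   Context: A lattice means a positive definite integral $\mathbb{Z}$-lattice on a quadratic space over $\mathbb{Q}$, with quadratic map $Q$. For a lattice $N$ of rank $r$, its successive minima $\mu_1(N)\le\cdots\le\mu_r(N)$ are defined by: $\mu_i(N)$ is the least real number $\mu$ such that $N$ contains $i$ linearly independent vectors $v$ with $Q(v)\le\mu$. A sublattice is primitive if it is a direct summand. $K$ is represented by $L$ if there is an isometry $\sigma$ with $\sigma(K)\subseteq L$, primitively if $\sigma(K)$ is a primitive sublattice of $L$. -}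

module Defs where

open import Data.Nat using (ℕ; zero; suc; _≤_; _⊔_; _*_)
open import Data.Integer as ℤ using (ℤ; +_) renaming (_+_ to _+ℤ_; _*_ to _*ℤ_; _≤_ to _≤ℤ_; _<_ to _<ℤ_)
open import Data.Fin using (Fin; zero; suc)
open import Data.Product using (Σ; ∃; _×_)
open import Data.Unit using (⊤)
open import Relation.Nullary using (¬_)
open import Relation.Binary.PropositionalEquality using (_≡_)

-- Vectors of ℤⁿ (coordinates w.r.t. a fixed basis of the lattice)
Vecℤ : ℕ → Set
Vecℤ n = Fin n → ℤ

_≋_ : ∀ {n} → Vecℤ n → Vecℤ n → Set
u ≋ v = ∀ i → u i ≡ v i

0v : ∀ {n} → Vecℤ n
0v _ = + 0

_⊕_ : ∀ {n} → Vecℤ n → Vecℤ n → Vecℤ n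
(u ⊕ v) i = u i +ℤ v i

sumFin : (n : ℕ) → (Fin n → ℤ) → ℤ
sumFin zero    f = + 0
sumFin (suc n) f = f zero +ℤ sumFin n (λ i → f (suc i))

lincomb : ∀ {r n} → (Fin r → ℤ) → (Fin r → Vecℤ n) → Vecℤ n
lincomb {r} c w i = sumFin r (λ j → c j *ℤ w j i)

span : ∀ {r n} → (Fin r → Vecℤ n) → Vecℤ n → Set
span {r} w x = ∃ λ (c : Fin r → ℤ) → x ≋ lincomb c w

whole : ∀ {n} → Vecℤ n → Set
whole _ = ⊤

LinIndep : ∀ {r n} → (Fin r → Vecℤ n) → Set
LinIndep {r} w = ∀ (c : Fin r → ℤ) → lincomb c w ≋ 0v → ∀ j → c j ≡ + 0

Qf : ∀ {n} → (Fin n → Fin n → ℤ) → Vecℤ n → ℤ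
Qf {n} G v = sumFin n (λ i → sumFin n (λ j → v i *ℤ (G i j *ℤ v j)))

-- positive definite integral ℤ-lattice of rank n, given by its (integral,
-- symmetric) Gram matrix B(e_i,e_j) w.r.t. a basis e_1..e_n
record Lattice (n : ℕ) : Set where
  field
    gram   : Fin n → Fin n → ℤ
    sym    : ∀ i j → gram i j ≡ gram j i
    posdef : ∀ v → ¬ (v ≋ 0v) → + 0 <ℤ Qf gram v
open Lattice public

Q : ∀ {n} → Lattice n → Vecℤ n → ℤ
Q L = Qf (gram L)

-- F is a direct summand of the submodule A (F ⊆ A assumed):
-- there is a submodule N ⊆ A (spanned by a finite family w) with A = F ⊕ N
DirectSummandIn : ∀ {n} → (Vecℤ n → Set) → (Vecℤ n → Set) → Set
DirectSummandIn {n} A F =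
  ∃ λ (r : ℕ) → ∃ λ (w : Fin r → Vecℤ n) →
    (∀ j → A (w j)) ×
    (∀ x → A x → ∃ λ a → ∃ λ b → F a × span w b × (x ≋ (a ⊕ b))) ×
    (∀ y → F y → span w y → y ≋ 0v)

-- σ : K → L, the ℤ-linear map sending the i-th basis vector of K to f i,
-- is an isometry (preserves Q)
IsIsometry : ∀ {k n} → Lattice k → Lattice n → (Fin k → Vecℤ n) → Set
IsIsometry K L f = ∀ v → Q L (lincomb v f) ≡ Q K v

-- K represented by the sublattice S of L (S = whole: by L itself)
RepresentedIn : ∀ {k n} → Lattice k → Lattice n → (Vecℤ n → Set) → Set
RepresentedIn K L S = ∃ λ f → IsIsometry K L f × (∀ i → S (f i))

PrimRepresentedIn : ∀ {k n} → Lattice k → Lattice n → (Vecℤ n → Set) → Set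
PrimRepresentedIn K L S =
  ∃ λ f → IsIsometry K L f × (∀ i → S (f i)) × DirectSummandIn S (span f)

HasIndep : ∀ {n} → Lattice n → (Vecℤ n → Set) → ℕ → ℕ → Set
HasIndep {n} L N i μ = ∃ λ (v : Fin i → Vecℤ n) →
  (∀ j → N (v j)) × LinIndep v × (∀ j → Q L (v j) ≤ℤ + μ)

-- μ is the i-th successive minimum μ_i(N)  (Q is ℤ-valued and ≥ 0, so the
-- least such real number is a natural number; μ_0 = 0 by this convention)
IsSuccMin : ∀ {n} → Lattice n → (Vecℤ n → Set) → ℕ → ℕ → Set
IsSuccMin L N i μ = HasIndep L N i μ × (∀ μ' → HasIndep L N i μ' → μ ≤ μ')

MinimaBound : ∀ {k m n} → ℕ → Lattice n → (Fin m → Vecℤ n) → Lattice k → Set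
MinimaBound {k} {m} C L Mb K =
  ∀ μL μK μM →
    IsSuccMin L whole (suc m) μL →
    IsSuccMin K whole k μK →
    IsSuccMin L (span Mb) m μM →
    μL ≤ C * (μK ⊔ μM)

{-# OPTIONS --safe #-}
-- If μ_{m+1}(L) exceeded μ := max{μ_k(K), μ_m(M)}, every vector of L of norm at most μ
-- would lie in M: otherwise it would extend m independent vectors of M of norm at most μ
-- to m+1 independent vectors of L, since M, being primitive, is saturated (d x ∈ M with
-- d ≠ 0 forces x ∈ M).  In particular the images σ(u_j) of k independent vectors of K of
-- norm at most μ_k(K) lie in M; as the u_j span a sublattice of finite index of K and M is
-- saturated, σ(K) ⊆ M, so K would be represented by M.  Hence the bound holds with C = 1
-- for all k and m.
module Submission where

open import Defs hiding (sym)
open import Data.Nat using (ℕ; _≤_; _⊔_)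
open import Data.Fin using (Fin)
open import Data.Product using (Σ; _×_)
open import Relation.Nullary using (¬_)
open import Relation.Binary.PropositionalEquality using (_≡_)

open import Data.Nat using (zero; suc; s≤s; _<_; _≤?_)
import Data.Nat.Properties as ℕP
open import Data.Fin using (zero; suc; punchIn)
import Data.Fin.Properties as FinP
open import Data.Vec.Functional using (_∷_; tail)
open import Data.Integer as ℤ using (ℤ; +_; -1ℤ; _-_)
  renaming (_+_ to _+ℤ_; _*_ to _*ℤ_; _≤_ to _≤ℤ_)
import Data.Integer.Properties as ℤP
open import Data.Integer.Tactic.RingSolver using (solve-∀)
open import Algebra.Properties.AbelianGroup ℤP.+-0-abelianGroup using (inverseˡ-unique)
open import Algebra.Properties.CommutativeSemigroup ℤP.+-commutativeSemigroup using (interchange)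
open import Data.Product using (_,_; proj₁; proj₂; ∃)
open import Data.Sum using (_⊎_; inj₁; inj₂; [_,_]′)
open import Data.Unit using (tt)
open import Data.Empty using (⊥-elim)
open import Function using (id; _∘_)
open import Relation.Nullary using (yes; no)
open import Relation.Nullary.Decidable using (decidable-stable)
open import Relation.Binary.PropositionalEquality using (refl; sym; trans; cong; cong₂; module ≡-Reasoning)

sumFin-cong : ∀ n {f g : Fin n → ℤ} → (∀ i → f i ≡ g i) → sumFin n f ≡ sumFin n g
sumFin-cong zero    f≗g = refl
sumFin-cong (suc n) f≗g = cong₂ _+ℤ_ (f≗g zero) (sumFin-cong n (f≗g ∘ suc))

sumFin-zero : ∀ n {f : Fin n → ℤ} → (∀ i → f i ≡ + 0) → sumFin n f ≡ + 0
sumFin-zero zero    f≗0 = refl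
sumFin-zero (suc n) f≗0 = cong₂ _+ℤ_ (f≗0 zero) (sumFin-zero n (f≗0 ∘ suc))

sumFin-+ : ∀ n (f g : Fin n → ℤ) → sumFin n (λ i → f i +ℤ g i) ≡ sumFin n f +ℤ sumFin n g
sumFin-+ zero    f g = refl
sumFin-+ (suc n) f g = trans (cong (f zero +ℤ g zero +ℤ_) (sumFin-+ n (f ∘ suc) (g ∘ suc)))
                             (interchange (f zero) (g zero) _ _)

sumFin-*ˡ : ∀ n a (f : Fin n → ℤ) → sumFin n (λ i → a *ℤ f i) ≡ a *ℤ sumFin n f
sumFin-*ˡ zero    a f = sym (ℤP.*-zeroʳ a)
sumFin-*ˡ (suc n) a f = trans (cong (a *ℤ f zero +ℤ_) (sumFin-*ˡ n a (f ∘ suc)))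
                              (sym (ℤP.*-distribˡ-+ a (f zero) _))

+≡0⇒≡-1* : ∀ a b → a +ℤ b ≡ + 0 → a ≡ -1ℤ *ℤ b
+≡0⇒≡-1* a b a+b≡0 = trans (inverseˡ-unique a b a+b≡0) (sym (ℤP.-1*i≡-i b))

infixr 25 _·_

_·_ : ∀ {n} → ℤ → Vecℤ n → Vecℤ n
(a · v) i = a *ℤ v i

basis : ∀ {n} → Fin n → Vecℤ n
basis zero    zero    = + 1
basis zero    (suc j) = + 0
basis (suc i) zero    = + 0
basis (suc i) (suc j) = basis i j

lincomb-congˡ : ∀ {r n} {c c′ : Fin r → ℤ} (w : Fin r → Vecℤ n) → c ≋ c′ → lincomb c w ≋ lincomb c′ w
lincomb-congˡ {r} w c≋c′ i = sumFin-cong r (λ j → cong (_*ℤ _) (c≋c′ j))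

lincomb-congʳ : ∀ {r n} (c : Fin r → ℤ) {w w′ : Fin r → Vecℤ n} →
  (∀ j → w j ≋ w′ j) → lincomb c w ≋ lincomb c w′
lincomb-congʳ {r} c w≋w′ i = sumFin-cong r (λ j → cong (c j *ℤ_) (w≋w′ j i))

lincomb-⊕ˡ : ∀ {r n} (c c′ : Fin r → ℤ) (w : Fin r → Vecℤ n) →
  lincomb (c ⊕ c′) w ≋ (lincomb c w ⊕ lincomb c′ w)
lincomb-⊕ˡ {r} c c′ w i = trans (sumFin-cong r (λ j → ℤP.*-distribʳ-+ (w j i) (c j) (c′ j))) (sumFin-+ r _ _)

lincomb-⊕ʳ : ∀ {r n} (c : Fin r → ℤ) (w w′ : Fin r → Vecℤ n) →
  lincomb c (λ j → w j ⊕ w′ j) ≋ (lincomb c w ⊕ lincomb c w′)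
lincomb-⊕ʳ {r} c w w′ i = trans (sumFin-cong r (λ j → ℤP.*-distribˡ-+ (c j) (w j i) (w′ j i))) (sumFin-+ r _ _)

lincomb-· : ∀ {r n} a (c : Fin r → ℤ) (w : Fin r → Vecℤ n) → lincomb (a · c) w ≋ (a · lincomb c w)
lincomb-· {r} a c w i = trans (sumFin-cong r (λ j → ℤP.*-assoc a (c j) (w j i))) (sumFin-*ˡ r a _)

lincomb-0v : ∀ {r n} (w : Fin r → Vecℤ n) → lincomb 0v w ≋ 0v
lincomb-0v {r} w i = sumFin-zero r (λ j → ℤP.*-zeroˡ (w j i))

lincomb-basis : ∀ {r n} (i : Fin r) (w : Fin r → Vecℤ n) → lincomb (basis i) w ≋ w i
lincomb-basis {suc r} zero w x =
  trans (cong₂ _+ℤ_ (ℤP.*-identityˡ (w zero x)) (sumFin-zero r (λ j → ℤP.*-zeroˡ (w (suc j) x))))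
        (ℤP.+-identityʳ (w zero x))
lincomb-basis {suc r} (suc i) w x =
  trans (cong₂ _+ℤ_ (ℤP.*-zeroˡ (w zero x)) (lincomb-basis i (tail w) x)) (ℤP.+-identityˡ (w (suc i) x))

record IsSubmodule {n} (P : Vecℤ n → Set) : Set where
  field
    ≋-resp   : ∀ {x y} → x ≋ y → P x → P y
    0v∈      : P 0v
    ⊕-closed : ∀ {x y} → P x → P y → P (x ⊕ y)
    ·-closed : ∀ a {x} → P x → P (a · x)
open IsSubmodule

lincomb-closed : ∀ {n r} {P : Vecℤ n → Set} → IsSubmodule P → (c : Fin r → ℤ) (w : Fin r → Vecℤ n) →
  (∀ j → P (w j)) → P (lincomb c w)
lincomb-closed {r = zero}  S c w w∈P = S .0v∈
lincomb-closed {r = suc r} S c w w∈P =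
  S .⊕-closed (S .·-closed (c zero) (w∈P zero)) (lincomb-closed S (tail c) (tail w) (w∈P ∘ suc))

span-isSubmodule : ∀ {r n} (g : Fin r → Vecℤ n) → IsSubmodule (span g)
span-isSubmodule g .≋-resp x≋y (c , x≋gc) = c , λ i → trans (sym (x≋y i)) (x≋gc i)
span-isSubmodule g .0v∈ = 0v , λ i → sym (lincomb-0v g i)
span-isSubmodule g .⊕-closed (c , x≋gc) (c′ , y≋gc′) =
  c ⊕ c′ , λ i → trans (cong₂ _+ℤ_ (x≋gc i) (y≋gc′ i)) (sym (lincomb-⊕ˡ c c′ g i))
span-isSubmodule g .·-closed a (c , x≋gc) =
  a · c , λ i → trans (cong (a *ℤ_) (x≋gc i)) (sym (lincomb-· a c g i))

generator∈span : ∀ {r n} (g : Fin r → Vecℤ n) i → span g (g i)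
generator∈span g i = basis i , λ x → sym (lincomb-basis i g x)

span-⊆ : ∀ {r s n} {g : Fin r → Vecℤ n} (h : Fin s → Vecℤ n) → (∀ j → span g (h j)) →
  ∀ x → span h x → span g x
span-⊆ {g = g} h h∈g x (c , x≋hc) =
  span-isSubmodule g .≋-resp (λ i → sym (x≋hc i)) (lincomb-closed (span-isSubmodule g) c h h∈g)

Saturated : ∀ {n} → (Vecℤ n → Set) → Set
Saturated P = ∀ d x → ¬ (d ≡ + 0) → P (d · x) → P x

directSummand⇒saturated : ∀ {m n} (Mb : Fin m → Vecℤ n) →
  DirectSummandIn whole (span Mb) → Saturated (span Mb)
directSummand⇒saturated Mb (_ , w , _ , decompose , disjoint) d x d≢0 dx∈M
  with decompose x tt
... | a , b , a∈M , b∈W , x≋a⊕b = M .≋-resp (λ i → sym (x≡a i)) a∈M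
  where
  M = span-isSubmodule Mb
  db≋dx-da : ∀ i → ((d · x) ⊕ (-1ℤ · d · a)) i ≡ (d · b) i
  db≋dx-da i rewrite x≋a⊕b i = lemma d (a i) (b i)
    where
    lemma : ∀ d a b → d *ℤ (a +ℤ b) +ℤ -1ℤ *ℤ (d *ℤ a) ≡ d *ℤ b
    lemma = solve-∀
  db≋0 : d · b ≋ 0v
  db≋0 = disjoint (d · b) (M .≋-resp db≋dx-da (M .⊕-closed dx∈M (M .·-closed -1ℤ (M .·-closed d a∈M))))
                          (span-isSubmodule w .·-closed d b∈W)
  x≡a : ∀ i → x i ≡ a i
  x≡a i rewrite x≋a⊕b i with ℤP.i*j≡0⇒i≡0∨j≡0 d (db≋0 i)
  ... | inj₁ d≡0 = ⊥-elim (d≢0 d≡0)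
  ... | inj₂ bi≡0 = trans (cong (a i +ℤ_) bi≡0) (ℤP.+-identityʳ (a i))

NontrivialRelation : ∀ {r n} → (Fin r → Vecℤ n) → Set
NontrivialRelation {r} v = ∃ λ (c : Fin r → ℤ) → lincomb c v ≋ 0v × ∃ λ j → ¬ (c j ≡ + 0)

-- One step of fraction-free Gaussian elimination with pivot p q.
clear : ∀ {n} → Fin n → Vecℤ n → Vecℤ n → Vecℤ n
clear q p x i = p q *ℤ x i - x q *ℤ p i

clear-pivot : ∀ {n} (q : Fin n) p x → clear q p x q ≡ + 0
clear-pivot q p x = lemma (p q) (x q)
  where
  lemma : ∀ a b → a *ℤ b - b *ℤ a ≡ + 0
  lemma = solve-∀

lincomb-clear : ∀ {r n} (q : Fin n) p (V : Fin r → Vecℤ n) (c : Fin r → ℤ) →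
  lincomb c (λ j → clear q p (V j)) ≋ lincomb ((-1ℤ *ℤ lincomb c V q) ∷ p q · c) (p ∷ V)
lincomb-clear {r} q p V c i = begin
  sumFin r (λ j → c j *ℤ clear q p (V j) i)
    ≡⟨ sumFin-cong r (λ j → expand (p q) (c j) (V j i) (V j q) (p i)) ⟩
  sumFin r (λ j → p q *ℤ c j *ℤ V j i +ℤ p i *ℤ (-1ℤ *ℤ (c j *ℤ V j q)))
    ≡⟨ sumFin-+ r _ _ ⟩
  A +ℤ sumFin r (λ j → p i *ℤ (-1ℤ *ℤ (c j *ℤ V j q)))
    ≡⟨ cong (A +ℤ_) (trans (sumFin-*ˡ r (p i) _) (cong (p i *ℤ_) (sumFin-*ˡ r -1ℤ _))) ⟩
  A +ℤ p i *ℤ (-1ℤ *ℤ lincomb c V q)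
    ≡⟨ swap A (p i) _ ⟩
  (-1ℤ *ℤ lincomb c V q) *ℤ p i +ℤ A ∎
  where
  open ≡-Reasoning
  A = sumFin r (λ j → p q *ℤ c j *ℤ V j i)
  expand : ∀ a c x y z → c *ℤ (a *ℤ x - y *ℤ z) ≡ a *ℤ c *ℤ x +ℤ z *ℤ (-1ℤ *ℤ (c *ℤ y))
  expand = solve-∀
  swap : ∀ a z s → a +ℤ z *ℤ s ≡ s *ℤ z +ℤ a
  swap = solve-∀

≋0v-off-punchIn : ∀ {n} (q : Fin (suc n)) (u : Vecℤ (suc n)) →
  u q ≡ + 0 → (∀ i → u (punchIn q i) ≡ + 0) → u ≋ 0v
≋0v-off-punchIn q u uq≡0 rest≡0 i with i FinP.≟ q
... | yes refl = uq≡0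
... | no i≢q = trans (cong u (sym (FinP.punchIn-punchOut (i≢q ∘ sym)))) (rest≡0 _)

more-than-dim⇒nontrivialRelation : ∀ n r → n < r → (v : Fin r → Vecℤ n) → NontrivialRelation v
more-than-dim⇒nontrivialRelation zero (suc r) _ v = (λ _ → + 1) , (λ ()) , zero , λ ()
more-than-dim⇒nontrivialRelation (suc n) (suc r) (s≤s n<r) v with FinP.all? (λ i → v zero i ℤP.≟ + 0)
... | yes v₀≋0 = basis zero , (λ i → trans (lincomb-basis zero v i) (v₀≋0 i)) , zero , λ ()
... | no v₀≉0 with FinP.¬∀⟶∃¬ (suc n) _ (λ i → v zero i ℤP.≟ + 0) v₀≉0
... | q , v₀q≢0 with more-than-dim⇒nontrivialRelation n r n<r (λ j i → clear q (v zero) (v (suc j)) (punchIn q i))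
... | c , c-rel , j , cj≢0 =
  (-1ℤ *ℤ lincomb c (tail v) q) ∷ v zero q · c ,
  (λ i → trans (sym (lincomb-clear q (v zero) (tail v) c i)) (cleared-rel i)) ,
  suc j , [ v₀q≢0 , cj≢0 ]′ ∘ ℤP.i*j≡0⇒i≡0∨j≡0 (v zero q)
  where
  cleared-rel : lincomb c (λ j → clear q (v zero) (v (suc j))) ≋ 0v
  cleared-rel = ≋0v-off-punchIn q _
    (sumFin-zero r (λ j → trans (cong (c j *ℤ_) (clear-pivot q (v zero) (v (suc j)))) (ℤP.*-zeroʳ (c j))))
    c-rel

relation⇒∈⊎trivial : ∀ {n r} {P : Vecℤ n → Set} → IsSubmodule P → Saturated P →
  (x : Vecℤ n) (w : Fin r → Vecℤ n) → (∀ j → P (w j)) → LinIndep w →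
  (c : Fin (suc r) → ℤ) → lincomb c (x ∷ w) ≋ 0v → P x ⊎ (∀ j → c j ≡ + 0)
relation⇒∈⊎trivial S sat x w w∈P w-indep c rel with c zero ℤP.≟ + 0
... | no c₀≢0 = inj₁ (sat (c zero) x c₀≢0
  (S .≋-resp (λ i → sym (+≡0⇒≡-1* _ _ (rel i))) (S .·-closed -1ℤ (lincomb-closed S (tail c) w w∈P))))
... | yes c₀≡0 = inj₂ λ { zero → c₀≡0 ; (suc j) → w-indep (tail c) tail-rel j }
  where
  tail-rel : lincomb (tail c) w ≋ 0v
  tail-rel i = trans (sym (trans (cong (_+ℤ lincomb (tail c) w i) (trans (cong (_*ℤ x i) c₀≡0) (ℤP.*-zeroˡ (x i))))
                                (ℤP.+-identityˡ _)))
                     (rel i)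

∷-linIndep : ∀ {n r} {P : Vecℤ n → Set} → IsSubmodule P → Saturated P →
  {x : Vecℤ n} {w : Fin r → Vecℤ n} → ¬ P x → (∀ j → P (w j)) → LinIndep w → LinIndep (x ∷ w)
∷-linIndep S sat {x} {w} x∉P w∈P w-indep c rel =
  [ ⊥-elim ∘ x∉P , id ]′ (relation⇒∈⊎trivial S sat x w w∈P w-indep c rel)

basis∈saturated : ∀ {k} {P : Vecℤ k → Set} → IsSubmodule P → Saturated P →
  (u : Fin k → Vecℤ k) → LinIndep u → (∀ j → P (u j)) → ∀ i → P (basis i)
basis∈saturated {k} S sat u u-indep u∈P i
  with more-than-dim⇒nontrivialRelation k (suc k) (ℕP.n<1+n k) (basis i ∷ u)
... | c , rel , j , cj≢0 =
  [ id , (λ c≡0 → ⊥-elim (cj≢0 (c≡0 j))) ]′ (relation⇒∈⊎trivial S sat (basis i) u u∈P u-indep c rel)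

preimage : ∀ {k n} → (Fin k → Vecℤ n) → (Vecℤ n → Set) → Vecℤ k → Set
preimage f M x = M (lincomb x f)

preimage-isSubmodule : ∀ {k n} {M : Vecℤ n → Set} → IsSubmodule M → (f : Fin k → Vecℤ n) →
  IsSubmodule (preimage f M)
preimage-isSubmodule S f .≋-resp x≋y = S .≋-resp (lincomb-congˡ f x≋y)
preimage-isSubmodule S f .0v∈ = S .≋-resp (λ i → sym (lincomb-0v f i)) (S .0v∈)
preimage-isSubmodule S f .⊕-closed {x} {y} fx∈M fy∈M =
  S .≋-resp (λ i → sym (lincomb-⊕ˡ x y f i)) (S .⊕-closed fx∈M fy∈M)
preimage-isSubmodule S f .·-closed a {x} fx∈M = S .≋-resp (λ i → sym (lincomb-· a x f i)) (S .·-closed a fx∈M)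

preimage-saturated : ∀ {k n} {M : Vecℤ n → Set} → IsSubmodule M → Saturated M → (f : Fin k → Vecℤ n) →
  Saturated (preimage f M)
preimage-saturated S sat f d x d≢0 fdx∈M = sat d (lincomb x f) d≢0 (S .≋-resp (lincomb-· d x f) fdx∈M)

image⊆saturated : ∀ {k n} {M : Vecℤ n → Set} → IsSubmodule M → Saturated M →
  (f : Fin k → Vecℤ n) (u : Fin k → Vecℤ k) → LinIndep u → (∀ j → M (lincomb (u j) f)) →
  ∀ i → M (f i)
image⊆saturated S sat f u u-indep fu∈M i =
  S .≋-resp (lincomb-basis i f)
    (basis∈saturated (preimage-isSubmodule S f) (preimage-saturated S sat f) u u-indep fu∈M i)

¬¬-∀ : ∀ {k} {P : Fin k → Set} → (∀ j → ¬ ¬ P j) → ¬ ¬ (∀ j → P j)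
¬¬-∀ {zero}  _   ¬all = ¬all λ ()
¬¬-∀ {suc k} ¬¬P ¬all = ¬¬P zero λ p₀ → ¬¬-∀ (¬¬P ∘ suc) λ ps → ¬all λ { zero → p₀ ; (suc j) → ps j }

hasIndep-mono : ∀ {n i μ μ′} {L : Lattice n} {N : Vecℤ n → Set} → μ ≤ μ′ → HasIndep L N i μ → HasIndep L N i μ′
hasIndep-mono μ≤μ′ (v , v∈N , v-indep , Qv≤μ) = v , v∈N , v-indep , λ j → ℤP.≤-trans (Qv≤μ j) (ℤ.+≤+ μ≤μ′)

hasIndep-∷ : ∀ {n m μ} {L : Lattice n} {N : Vecℤ n → Set} → IsSubmodule N → Saturated N →
  {x : Vecℤ n} → ¬ N x → Q L x ≤ℤ + μ → HasIndep L N m μ → HasIndep L whole (suc m) μ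
hasIndep-∷ S sat x∉N Qx≤μ (v , v∈N , v-indep , Qv≤μ) =
  _ ∷ v , (λ _ → tt) , ∷-linIndep S sat x∉N v∈N v-indep , λ { zero → Qx≤μ ; (suc j) → Qv≤μ j }

-- Unlike the theorem, no LinIndep Mb is assumed: m independent short vectors of M come with μ_m(M).
minimaBound-1 : ∀ {k m n} (L : Lattice n) (Mb : Fin m → Vecℤ n) (K : Lattice k) →
  DirectSummandIn whole (span Mb) → (f : Fin k → Vecℤ n) → IsIsometry K L f →
  ¬ (∀ i → span Mb (f i)) → MinimaBound 1 L Mb K
minimaBound-1 {m = m} L Mb K M-summand f σ-isometry f⊈M μL μK μM
  (_ , μL-least) ((u , _ , u-indep , Qu≤μK) , _) (M-short-μM , _) =
  ℕP.≤-trans μL≤μ (ℕP.≤-reflexive (sym (ℕP.*-identityˡ μ)))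
  where
  μ = μK ⊔ μM
  M = span-isSubmodule Mb
  M-saturated = directSummand⇒saturated Mb M-summand
  M-short : HasIndep L (span Mb) m μ
  M-short = hasIndep-mono {L = L} {N = span Mb} (ℕP.m≤n⊔m μK μM) M-short-μM
  Qσu≤μ : ∀ j → Q L (lincomb (u j) f) ≤ℤ + μ
  Qσu≤μ j = ℤP.≤-trans (ℤP.≤-reflexive (σ-isometry (u j))) (ℤP.≤-trans (Qu≤μK j) (ℤ.+≤+ (ℕP.m≤m⊔n μK μM)))
  μL≤μ : μL ≤ μ
  μL≤μ = decidable-stable (μL ≤? μ) λ μL≰μ →
    ¬¬-∀ {P = λ j → span Mb (lincomb (u j) f)}
         (λ j σu∉M → μL≰μ (μL-least μ (hasIndep-∷ {L = L} M M-saturated σu∉M (Qσu≤μ j) M-short)))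
         (f⊈M ∘ image⊆saturated M M-saturated f u u-indep)

-- The complement of span f in M is spanned by the W-components b i of the generators of M.
directSummand-restrict : ∀ {k m n} (Mb : Fin m → Vecℤ n) (f : Fin k → Vecℤ n) → (∀ i → span Mb (f i)) →
  DirectSummandIn whole (span f) → DirectSummandIn (span Mb) (span f)
directSummand-restrict {m = m} {n = n} Mb f f⊆M (_ , w , _ , decompose , disjoint) =
  m , b , b⊆M , decomposeM , λ y y∈F y∈B → disjoint y y∈F (span-⊆ b b⊆W y y∈B)
  where
  a b : Fin m → Vecℤ n
  a i = proj₁ (decompose (Mb i) tt)
  b i = proj₁ (proj₂ (decompose (Mb i) tt))
  a⊆F : ∀ i → span f (a i)
  a⊆F i = proj₁ (proj₂ (proj₂ (decompose (Mb i) tt)))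
  b⊆W : ∀ i → span w (b i)
  b⊆W i = proj₁ (proj₂ (proj₂ (proj₂ (decompose (Mb i) tt))))
  Mb≋a⊕b : ∀ i → Mb i ≋ (a i ⊕ b i)
  Mb≋a⊕b i = proj₂ (proj₂ (proj₂ (proj₂ (decompose (Mb i) tt))))
  M = span-isSubmodule Mb
  b⊆M : ∀ i → span Mb (b i)
  b⊆M i = M .≋-resp (λ x → trans (cong (λ z → z +ℤ -1ℤ *ℤ a i x) (Mb≋a⊕b i x)) (cancel (a i x) (b i x)))
                    (M .⊕-closed (generator∈span Mb i) (M .·-closed -1ℤ (span-⊆ f f⊆M (a i) (a⊆F i))))
    where
    cancel : ∀ x y → x +ℤ y +ℤ -1ℤ *ℤ x ≡ y
    cancel = solve-∀
  decomposeM : ∀ x → span Mb x → ∃ λ a′ → ∃ λ b′ → span f a′ × span b b′ × (x ≋ (a′ ⊕ b′))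
  decomposeM x (c , x≋Mc) =
    lincomb c a , lincomb c b , lincomb-closed (span-isSubmodule f) c a a⊆F , (c , λ _ → refl) ,
    λ i → trans (x≋Mc i) (trans (lincomb-congʳ c Mb≋a⊕b i) (lincomb-⊕ʳ c a b i))

lemma2p4 : (k m : ℕ) → Σ ℕ λ C →
  (k ⊔ m ≤ 4 → C ≡ 1) ×
  ((n : ℕ) (L : Lattice n) (Mb : Fin m → Vecℤ n) (K : Lattice k) →
    LinIndep Mb → DirectSummandIn whole (span Mb) →
    RepresentedIn K L whole → ¬ RepresentedIn K L (span Mb) →
    MinimaBound C L Mb K) ×
  ((n : ℕ) (L : Lattice n) (Mb : Fin m → Vecℤ n) (K : Lattice k) →
    LinIndep Mb → DirectSummandIn whole (span Mb) →
    PrimRepresentedIn K L whole → ¬ PrimRepresentedIn K L (span Mb) →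
    MinimaBound C L Mb K)
lemma2p4 k m = 1 , (λ _ → refl) ,
  (λ n L Mb K _ M-summand (f , σ-isometry , _) K↛M →
     minimaBound-1 L Mb K M-summand f σ-isometry (λ f⊆M → K↛M (f , σ-isometry , f⊆M))) ,
  (λ n L Mb K _ M-summand (f , σ-isometry , _ , σK-summand) K↛M →
     minimaBound-1 L Mb K M-summand f σ-isometry
       (λ f⊆M → K↛M (f , σ-isometry , f⊆M , directSummand-restrict Mb f f⊆M σK-summand)))
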